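{- Let $m \ge 2$ and $n \ge 3$ be integers with $m \mid n$, and let $D_{2n}$ be the dihedral group of order $2n$ and $C_m$ the cyclic group of order $m$. Then: (a) ${\sf d}(D_{2n} \times C_m) \ge m + n - 1$. (b) If $n$ is even, then ${\sf \eta}(D_{2n} \times C_m) \ge 2m + n - 1$.
   Context: For a finite group $G$, a sequence over $G$ is a finite unordered list of elements of $G$ with repetitions allowed; for $S = g_1\cdots g_k$, $\pi(S)$ is the set of all products $g_{\tau(1)}\cdots g_{\tau(k)}$ over permutations $\tau$. $S$ is product-one free if no non-empty subsequence $T$ has $1 \in \pi(T)$. A short product-one sequence is a sequence $T$ with $1 \in \pi(T)$ and $1 \le |T| \le \exp(G)$. ${\sf d}(G)$ is the maximum length of a product-one free sequence over $G$; ${\sf \eta}(G)$ is the smallest $\ell>0$ such that every sequence over $G$ of length at least $\ell$ has a short product-one subsequence. -}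

module Defs where

open import Data.Nat using (ℕ; zero; suc; _+_; _∸_; _≤_; _<_; NonZero)
open import Data.Nat.DivMod using (_mod_)
open import Data.Fin using (Fin; toℕ)
open import Data.Product using (Σ; _×_; _,_; ∃-syntax)
open import Data.List using (List; foldr; length)
open import Data.List.Relation.Binary.Sublist.Propositional using (_⊆_)
open import Data.List.Relation.Binary.Permutation.Propositional using (_↭_)
open import Relation.Binary.PropositionalEquality using (_≡_)
open import Relation.Nullary using (¬_)

-- Generic notions for a (finite) group given by carrier, product, identity.
-- Sequences are lists (unordered: all notions below are invariant under
-- permutation); a subsequence is a sublist.

module SeqNotions {G : Set} (_·_ : G → G → G) (e : G) where

  prod : List G → G
  prod = foldr _·_ e

  OneInπ : List G → Set
  OneInπ T = ∃[ T′ ] (T′ ↭ T × prod T′ ≡ e)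

  pow : G → ℕ → G
  pow g zero    = e
  pow g (suc k) = g · pow g k

  IsExponent : ℕ → Set
  IsExponent k = 0 < k × (∀ g → pow g k ≡ e)
               × (∀ k′ → 0 < k′ → (∀ g → pow g k′ ≡ e) → k ≤ k′)

  ProductOneFree : List G → Set
  ProductOneFree S = ∀ T → T ⊆ S → 0 < length T → ¬ OneInπ T

  IsDavenport : ℕ → Set
  IsDavenport d = (∃[ S ] (ProductOneFree S × length S ≡ d))
                × (∀ S → ProductOneFree S → length S ≤ d)

  ShortProductOne : ℕ → List G → Set
  ShortProductOne ex T = 1 ≤ length T × length T ≤ ex × OneInπ T

  HasShortProductOneSub : ℕ → List G → Set
  HasShortProductOneSub ex S = ∃[ T ] (T ⊆ S × ShortProductOne ex T)

  EtaProp : ℕ → ℕ → Set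
  EtaProp ex ℓ = ∀ S → ℓ ≤ length S → HasShortProductOneSub ex S

  IsEta : ℕ → ℕ → Set
  IsEta ex η = 0 < η × EtaProp ex η × (∀ ℓ → 0 < ℓ → EtaProp ex ℓ → η ≤ ℓ)

-- The group D_{2n} × C_m.
-- An element (f , i , j) stands for (r^i s^f , c^j) where f ∈ {0,1},
-- r has order n, s^2 = 1, s r s = r^{-1}, and c generates C_m.

record DC (n m : ℕ) : Set where
  constructor ⟨_,_,_⟩
  field
    refl? : Fin 2
    rot   : Fin n
    cyc   : Fin m

module _ (n m : ℕ) .{{_ : NonZero n}} .{{_ : NonZero m}} where

  -- (r^i s^f)(r^i' s^f') = r^(i + (-1)^f i') s^(f+f')
  mulDC : DC n m → DC n m → DC n m
  mulDC ⟨ f , i , j ⟩ ⟨ f′ , i′ , j′ ⟩ =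
    ⟨ (toℕ f + toℕ f′) mod 2
    , rotPart f
    , (toℕ j + toℕ j′) mod m ⟩
    where
      rotPart : Fin 2 → Fin n
      rotPart Fin.zero = (toℕ i + toℕ i′) mod n
      rotPart (Fin.suc _) = (toℕ i + (n ∸ toℕ i′)) mod n

  oneDC : DC n m
  oneDC = ⟨ 0 mod 2 , 0 mod n , 0 mod m ⟩

-- Write r, s for the rotation and reflection of D_{2n} and c for the generator of C_m.
-- The reflection count, the C_m-coordinate and, on the rotation subgroup C_n × C_m,
-- the rotation coordinate are additive modulo 2, m and n respectively, so a product-one
-- subsequence of r^(n-1) s c^(m-1) (rc)^(m-1) with A copies of r, B of c and K of rc
-- has no s, n ∣ A + K and m ∣ B + K.  Without rc this forces the subsequence to be
-- empty, giving (a).  For (b), A + K < 2n leaves A + K ∈ {0, n}, and either case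
-- contradicts 1 ≤ A + B + K ≤ n, where n bounds the exponent when n is even.
module Submission where

open import Defs
open import Data.Nat using (ℕ; zero; suc; _+_; _*_; _∸_; _≤_; _<_; NonZero; z≤n; s≤s; >-nonZero⁻¹)
open import Data.Nat.Properties
open import Data.Nat.DivMod using (_%_; _mod_; m*n%n≡0; m<n⇒m%n≡m; %-distribˡ-+; m%n%n≡m%n; [m+n]%n≡m%n; n%n≡0; m/n*n≡m; _/_)
open import Data.Nat.Divisibility using (_∣_; divides-refl; m%n≡0⇒n∣m; n∣m⇒m%n≡0; ∣m⇒∣m*n; ∣-refl; ∣⇒≤)
open import Data.Nat.ListAction using (sum)
open import Data.Nat.ListAction.Properties using (sum-++; sum-↭)
open import Data.Nat.Tactic.RingSolver using (solve-∀)
open import Data.Fin using (Fin; toℕ)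
open import Data.Fin.Properties using (toℕ-fromℕ<; toℕ-injective; toℕ<n)
open import Data.List using (List; []; _∷_; map; replicate; _++_; length)
open import Data.List.Properties using (map-++; length-++; length-replicate)
open import Data.List.Relation.Unary.All using (All; []; _∷_; universal)
open import Data.List.Relation.Unary.All.Properties using (++⁺; replicate⁺)
open import Data.List.Relation.Binary.Sublist.Propositional using (_⊆_; []; _∷_; _∷ʳ_)
open import Data.List.Relation.Binary.Permutation.Propositional using (↭-sym)
open import Data.List.Relation.Binary.Permutation.Propositional.Properties using (All-resp-↭; map⁺)
open import Data.Product using (_×_; _,_; ∃-syntax)
open import Data.Sum using (_⊎_; inj₁; inj₂)
open import Data.Unit using (⊤; tt)
open import Function using (case_of_)
open import Relation.Nullary using (¬_; contradiction)
open import Relation.Binary.PropositionalEquality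

[m+n%d]%d≡[m+n]%d : ∀ m n d .{{_ : NonZero d}} → (m + n % d) % d ≡ (m + n) % d
[m+n%d]%d≡[m+n]%d m n d = begin
  (m + n % d) % d           ≡⟨ %-distribˡ-+ m (n % d) d ⟩
  (m % d + n % d % d) % d   ≡⟨ cong (λ x → (m % d + x) % d) (m%n%n≡m%n n d) ⟩
  (m % d + n % d) % d       ≡⟨ %-distribˡ-+ m n d ⟨
  (m + n) % d               ∎
  where open ≡-Reasoning

m%n≡0∧m<n⇒m≡0 : ∀ {m n} .{{_ : NonZero n}} → m % n ≡ 0 → m < n → m ≡ 0
m%n≡0∧m<n⇒m≡0 m%n≡0 m<n = trans (sym (m<n⇒m%n≡m m<n)) m%n≡0

m%n≡0∧m<n+n⇒m≡0⊎m≡n : ∀ {m n} .{{_ : NonZero n}} → m % n ≡ 0 → m < n + n → m ≡ 0 ⊎ m ≡ n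
m%n≡0∧m<n+n⇒m≡0⊎m≡n {m} {n} m%n≡0 m<n+n with m%n≡0⇒n∣m m n m%n≡0
... | divides-refl zero          = inj₁ refl
... | divides-refl (suc zero)    = inj₂ (+-identityʳ n)
... | divides-refl (suc (suc q)) = contradiction m<n+n (≤⇒≯ (+-monoʳ-≤ n (m≤m+n n (q * n))))

-- K + A and K + B are the rotation and C_m coordinate sums, K + (A + B) the length.
short-zero-sum : ∀ {n m A B K} .{{_ : NonZero n}} .{{_ : NonZero m}} →
  m ≤ n → A < n → B < m → K < m → (K + A) % n ≡ 0 → (K + B) % m ≡ 0 →
  K + (A + B) ≤ n → K + (A + B) ≡ 0
short-zero-sum {K = K} m≤n A<n B<m K<m KA%n KB%m bound
  with m%n≡0∧m<n+n⇒m≡0⊎m≡n KA%n (+-mono-< (≤-trans K<m m≤n) A<n)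
... | inj₁ K+A≡0 with m+n≡0⇒m≡0 K K+A≡0 | m+n≡0⇒n≡0 K K+A≡0
...   | refl | refl = m%n≡0∧m<n⇒m≡0 KB%m B<m
short-zero-sum {n} {m} {A} {B} {K} m≤n A<n B<m K<m KA%n KB%m bound
    | inj₂ K+A≡n = contradiction A≡n (<⇒≢ A<n)
  where
  n+B≤n : n + B ≤ n + 0
  n+B≤n = begin
    n + B        ≡⟨ cong (_+ B) K+A≡n ⟨
    K + A + B    ≡⟨ +-assoc K A B ⟩
    K + (A + B)  ≤⟨ bound ⟩
    n            ≡⟨ +-identityʳ n ⟨
    n + 0        ∎
    where open ≤-Reasoning
  B≡0 : B ≡ 0
  B≡0 = n≤0⇒n≡0 (+-cancelˡ-≤ n B 0 n+B≤n)
  K+B≡K : K + B ≡ K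
  K+B≡K = trans (cong (K +_) B≡0) (+-identityʳ K)
  K≡0 : K ≡ 0
  K≡0 = m%n≡0∧m<n⇒m≡0 (subst (λ x → x % m ≡ 0) K+B≡K KB%m) K<m
  A≡n : A ≡ n
  A≡n = trans (cong (_+ A) (sym K≡0)) K+A≡n

sum-map-replicate : ∀ {A : Set} (h : A → ℕ) k x → sum (map h (replicate k x)) ≡ k * h x
sum-map-replicate h zero    x = refl
sum-map-replicate h (suc k) x = cong (h x +_) (sum-map-replicate h k x)

sum-map-++ : ∀ {A : Set} (h : A → ℕ) xs ys → sum (map h (xs ++ ys)) ≡ sum (map h xs) + sum (map h ys)
sum-map-++ h xs ys = trans (cong sum (map-++ h xs ys)) (sum-++ (map h xs) (map h ys))

⊆-replicate-++ : ∀ {A : Set} {x : A} a {ys T : List A} → T ⊆ replicate a x ++ ys →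
  ∃[ k ] ∃[ T′ ] (k ≤ a × T′ ⊆ ys × T ≡ replicate k x ++ T′)
⊆-replicate-++ zero    T⊆ys = 0 , _ , z≤n , T⊆ys , refl
⊆-replicate-++ (suc a) (_ ∷ʳ T⊆) with ⊆-replicate-++ a T⊆
... | k , T′ , k≤a , T′⊆ys , refl = k , T′ , m≤n⇒m≤1+n k≤a , T′⊆ys , refl
⊆-replicate-++ (suc a) (refl ∷ T⊆) with ⊆-replicate-++ a T⊆
... | k , T′ , k≤a , T′⊆ys , refl = suc k , T′ , s≤s k≤a , T′⊆ys , refl

⊆-replicate : ∀ {A : Set} {x : A} a {T : List A} → T ⊆ replicate a x → ∃[ k ] (k ≤ a × T ≡ replicate k x)
⊆-replicate zero    [] = 0 , z≤n , refl
⊆-replicate (suc a) (_ ∷ʳ T⊆) with ⊆-replicate a T⊆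
... | k , k≤a , refl = k , m≤n⇒m≤1+n k≤a , refl
⊆-replicate (suc a) (refl ∷ T⊆) with ⊆-replicate a T⊆
... | k , k≤a , refl = suc k , s≤s k≤a , refl

module Residue {G : Set} (_·_ : G → G → G) (e : G) where
  open SeqNotions _·_ e

  record ResidueHom (k : ℕ) .{{_ : NonZero k}} (P : G → Set) (h : G → ℕ) : Set where
    field
      h-e : h e ≡ 0
      h-· : ∀ {x} y → P x → h (x · y) ≡ (h x + h y) % k

  pow≡prod-replicate : ∀ g t → pow g t ≡ prod (replicate t g)
  pow≡prod-replicate g zero    = refl
  pow≡prod-replicate g (suc t) = cong (g ·_) (pow≡prod-replicate g t)

  module _ {k} .{{_ : NonZero k}} {P : G → Set} {h : G → ℕ} (hom : ResidueHom k P h) where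
    open ResidueHom hom

    prod-residue : ∀ {xs} → All P xs → h (prod xs) ≡ sum (map h xs) % k
    prod-residue [] = trans h-e (sym (m*n%n≡0 0 k))
    prod-residue {x ∷ xs} (px ∷ pxs) = begin
      h (x · prod xs)                ≡⟨ h-· (prod xs) px ⟩
      (h x + h (prod xs)) % k        ≡⟨ cong (λ y → (h x + y) % k) (prod-residue pxs) ⟩
      (h x + sum (map h xs) % k) % k ≡⟨ [m+n%d]%d≡[m+n]%d (h x) (sum (map h xs)) k ⟩
      (h x + sum (map h xs)) % k     ∎
      where open ≡-Reasoning

    OneInπ⇒sum%≡0 : ∀ {T} → All P T → OneInπ T → sum (map h T) % k ≡ 0
    OneInπ⇒sum%≡0 {T} PT (T′ , T′↭T , prodT′≡e) = begin
      sum (map h T) % k   ≡⟨ cong (_% k) (sum-↭ (map⁺ h T′↭T)) ⟨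
      sum (map h T′) % k  ≡⟨ prod-residue (All-resp-↭ (↭-sym T′↭T) PT) ⟨
      h (prod T′)         ≡⟨ cong h prodT′≡e ⟩
      h e                 ≡⟨ h-e ⟩
      0                   ∎
      where open ≡-Reasoning

    pow-residue : ∀ {g} t → P g → h (pow g t) ≡ (t * h g) % k
    pow-residue {g} t Pg = begin
      h (pow g t)                       ≡⟨ cong h (pow≡prod-replicate g t) ⟩
      h (prod (replicate t g))          ≡⟨ prod-residue (replicate⁺ t Pg) ⟩
      sum (map h (replicate t g)) % k   ≡⟨ cong (_% k) (sum-map-replicate h t g) ⟩
      (t * h g) % k                     ∎
      where open ≡-Reasoning

    pow-multiple-residue : ∀ {g t} → P g → k ∣ t → h (pow g t) ≡ 0
    pow-multiple-residue {g} {t} Pg k∣t =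
      trans (pow-residue t Pg) (n∣m⇒m%n≡0 (t * h g) k (∣m⇒∣m*n (h g) k∣t))

toℕ-0mod : ∀ k .{{_ : NonZero k}} → toℕ (0 mod k) ≡ 0
toℕ-0mod k = trans (toℕ-fromℕ< _) (m*n%n≡0 0 k)

module _ {n m : ℕ} .{{_ : NonZero n}} .{{_ : NonZero m}} where
  open SeqNotions (mulDC n m) (oneDC n m)
  open Residue (mulDC n m) (oneDC n m)

  reflection rotation cyclic : DC n m → ℕ
  reflection x = toℕ (DC.refl? x)
  rotation   x = toℕ (DC.rot x)
  cyclic     x = toℕ (DC.cyc x)

  IsRotation : DC n m → Set
  IsRotation x = DC.refl? x ≡ Fin.zero

  coordinates≡0⇒≡one : ∀ {x} → reflection x ≡ 0 → rotation x ≡ 0 → cyclic x ≡ 0 → x ≡ oneDC n m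
  coordinates≡0⇒≡one f≡0 i≡0 j≡0
    with toℕ-injective (trans f≡0 (sym (toℕ-0mod 2)))
       | toℕ-injective (trans i≡0 (sym (toℕ-0mod n)))
       | toℕ-injective (trans j≡0 (sym (toℕ-0mod m)))
  ... | refl | refl | refl = refl

  reflection-residue : ResidueHom 2 (λ _ → ⊤) reflection
  reflection-residue = record { h-e = toℕ-0mod 2 ; h-· = λ _ _ → toℕ-fromℕ< _ }

  cyclic-residue : ResidueHom m (λ _ → ⊤) cyclic
  cyclic-residue = record { h-e = toℕ-0mod m ; h-· = λ _ _ → toℕ-fromℕ< _ }

  rotation-residue : ResidueHom n IsRotation rotation
  rotation-residue = record { h-e = toℕ-0mod n ; h-· = λ {x} → rotation-· {x} }
    where
    rotation-· : ∀ {x} y → IsRotation x → rotation (mulDC n m x y) ≡ (rotation x + rotation y) % n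
    rotation-· {⟨ Fin.zero , i , j ⟩} y refl = toℕ-fromℕ< _

  -- A reflection g is an involution on the dihedral factor: the rotation coordinate of
  -- g^t alternates between 0 and that of g.
  rotation-pow-reflection : ∀ {i j} q → rotation (pow ⟨ Fin.suc Fin.zero , i , j ⟩ (q * 2)) ≡ 0
  rotation-pow-reflection zero = toℕ-0mod n
  rotation-pow-reflection {i} {j} (suc q) = begin
    rotation (g · (g · p))                ≡⟨ toℕ-fromℕ< _ ⟩
    (toℕ i + (n ∸ rotation (g · p))) % n  ≡⟨ cong (λ ρ → (toℕ i + (n ∸ ρ)) % n) rotation-g·p ⟩
    (toℕ i + (n ∸ toℕ i)) % n             ≡⟨ cong (_% n) (m+[n∸m]≡n (<⇒≤ (toℕ<n i))) ⟩
    n % n                                 ≡⟨ n%n≡0 n ⟩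
    0                                     ∎
    where
    open ≡-Reasoning
    _·_ = mulDC n m
    g = ⟨ Fin.suc Fin.zero , i , j ⟩
    p = pow g (q * 2)
    rotation-g·p : rotation (g · p) ≡ toℕ i
    rotation-g·p = begin
      rotation (g · p)                      ≡⟨ toℕ-fromℕ< _ ⟩
      (toℕ i + (n ∸ rotation p)) % n        ≡⟨ cong (λ ρ → (toℕ i + (n ∸ ρ)) % n) (rotation-pow-reflection q) ⟩
      (toℕ i + n) % n                       ≡⟨ [m+n]%n≡m%n (toℕ i) n ⟩
      toℕ i % n                             ≡⟨ m<n⇒m%n≡m (toℕ<n i) ⟩
      toℕ i                                 ∎

  rotation-pow-n : 2 ∣ n → ∀ g → rotation (pow g n) ≡ 0
  rotation-pow-n _   ⟨ Fin.zero , i , j ⟩ = pow-multiple-residue rotation-residue refl ∣-refl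
  rotation-pow-n 2∣n ⟨ Fin.suc Fin.zero , i , j ⟩ =
    subst (λ t → rotation (pow ⟨ Fin.suc Fin.zero , i , j ⟩ t) ≡ 0) (m/n*n≡m 2∣n)
          (rotation-pow-reflection (n / 2))

  pow-n≡one : 2 ∣ n → m ∣ n → ∀ g → pow g n ≡ oneDC n m
  pow-n≡one 2∣n m∣n g =
    coordinates≡0⇒≡one (pow-multiple-residue reflection-residue tt 2∣n)
                       (rotation-pow-n 2∣n g)
                       (pow-multiple-residue cyclic-residue tt m∣n)

  exponent≤n : 2 ∣ n → m ∣ n → ∀ {ex} → IsExponent ex → ex ≤ n
  exponent≤n 2∣n m∣n (_ , _ , least) = least n (>-nonZero⁻¹ n) (pow-n≡one 2∣n m∣n)

module ExtremalSequences (n₀ m₀ : ℕ) where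
  n m : ℕ
  n = 2 + n₀
  m = 2 + m₀

  open SeqNotions (mulDC n m) (oneDC n m)
  open Residue (mulDC n m) (oneDC n m)

  r s c rc : DC n m
  r  = ⟨ Fin.zero , Fin.suc Fin.zero , Fin.zero ⟩
  s  = ⟨ Fin.suc Fin.zero , Fin.zero , Fin.zero ⟩
  c  = ⟨ Fin.zero , Fin.zero , Fin.suc Fin.zero ⟩
  rc = ⟨ Fin.zero , Fin.suc Fin.zero , Fin.suc Fin.zero ⟩

  word : ℕ → ℕ → ℕ → ℕ → List (DC n m)
  word A F B K = replicate A r ++ replicate F s ++ replicate B c ++ replicate K rc

  ⊆-word : ∀ {a f b k T} → T ⊆ word a f b k →
    ∃[ A ] ∃[ F ] ∃[ B ] ∃[ K ] (A ≤ a × F ≤ f × B ≤ b × K ≤ k × T ≡ word A F B K)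
  ⊆-word {a} {f} {b} {k} T⊆ with ⊆-replicate-++ a T⊆
  ... | A , _ , A≤a , T⊆₁ , refl with ⊆-replicate-++ f T⊆₁
  ... | F , _ , F≤f , T⊆₂ , refl with ⊆-replicate-++ b T⊆₂
  ... | B , _ , B≤b , T⊆₃ , refl with ⊆-replicate k T⊆₃
  ... | K , K≤k , refl = A , F , B , K , A≤a , F≤f , B≤b , K≤k , refl

  length-word : ∀ A F B K → length (word A F B K) ≡ K + (A + (F + B))
  length-word A F B K =
    trans (length-++ (replicate A r)) (trans (cong₂ _+_ (length-replicate A)
      (trans (length-++ (replicate F s)) (cong₂ _+_ (length-replicate F)
        (trans (length-++ (replicate B c)) (cong₂ _+_ (length-replicate B) (length-replicate K))))))
      (reorder A F B K))
    where
    reorder : ∀ A F B K → A + (F + (B + K)) ≡ K + (A + (F + B))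
    reorder = solve-∀

  sum-map-word : ∀ (h : DC n m → ℕ) A F B K →
    sum (map h (word A F B K)) ≡ A * h r + (F * h s + (B * h c + K * h rc))
  sum-map-word h A F B K =
    trans (sum-map-++ h (replicate A r) _) (cong₂ _+_ (sum-map-replicate h A r)
      (trans (sum-map-++ h (replicate F s) _) (cong₂ _+_ (sum-map-replicate h F s)
        (trans (sum-map-++ h (replicate B c) _) (cong₂ _+_ (sum-map-replicate h B c)
          (sum-map-replicate h K rc))))))

  reflection-sum : ∀ A F B K → sum (map reflection (word A F B K)) ≡ F
  reflection-sum A F B K = trans (sum-map-word reflection A F B K) (tidy A F B K)
    where
    tidy : ∀ A F B K → A * 0 + (F * 1 + (B * 0 + K * 0)) ≡ F
    tidy = solve-∀

  rotation-sum : ∀ A F B K → sum (map rotation (word A F B K)) ≡ K + A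
  rotation-sum A F B K = trans (sum-map-word rotation A F B K) (tidy A F B K)
    where
    tidy : ∀ A F B K → A * 1 + (F * 0 + (B * 0 + K * 1)) ≡ K + A
    tidy = solve-∀

  cyclic-sum : ∀ A F B K → sum (map cyclic (word A F B K)) ≡ K + B
  cyclic-sum A F B K = trans (sum-map-word cyclic A F B K) (tidy A F B K)
    where
    tidy : ∀ A F B K → A * 0 + (F * 0 + (B * 1 + K * 1)) ≡ K + B
    tidy = solve-∀

  OneInπ-word⇒reflections-even : ∀ {A F B K} → OneInπ (word A F B K) → F % 2 ≡ 0
  OneInπ-word⇒reflections-even {A} {F} {B} {K} π =
    subst (λ x → x % 2 ≡ 0) (reflection-sum A F B K)
          (OneInπ⇒sum%≡0 reflection-residue (universal (λ _ → tt) _) π)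

  OneInπ-word⇒residues : ∀ {A B K} → OneInπ (word A 0 B K) → (K + A) % n ≡ 0 × (K + B) % m ≡ 0
  OneInπ-word⇒residues {A} {B} {K} π =
    subst (λ x → x % n ≡ 0) (rotation-sum A 0 B K) (OneInπ⇒sum%≡0 rotation-residue rotations π) ,
    subst (λ x → x % m ≡ 0) (cyclic-sum A 0 B K) (OneInπ⇒sum%≡0 cyclic-residue (universal (λ _ → tt) _) π)
    where
    rotations : All IsRotation (word A 0 B K)
    rotations = ++⁺ (replicate⁺ A refl) (++⁺ (replicate⁺ B refl) (replicate⁺ K refl))

  product-one-subword : ∀ {a b k T} → T ⊆ word a 1 b k → OneInπ T →
    ∃[ A ] ∃[ B ] ∃[ K ] (A ≤ a × B ≤ b × K ≤ k × length T ≡ K + (A + B)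
                           × (K + A) % n ≡ 0 × (K + B) % m ≡ 0)
  product-one-subword T⊆ π with ⊆-word {f = 1} T⊆
  ... | A , .0 , B , K , A≤a , z≤n , B≤b , K≤k , refl =
    A , B , K , A≤a , B≤b , K≤k , length-word A 0 B K , OneInπ-word⇒residues {A} {B} {K} π
  ... | A , .1 , B , K , _ , s≤s z≤n , _ , _ , refl =
    case OneInπ-word⇒reflections-even {A} {1} {B} {K} π of λ ()

  Sa : List (DC n m)
  Sa = word (suc n₀) 1 (suc m₀) 0

  Sb : List (DC n m)
  Sb = word (suc n₀) 1 (suc m₀) (suc m₀)

  Sa-product-one-free : ProductOneFree Sa
  Sa-product-one-free T T⊆Sa 0<|T| π with product-one-subword T⊆Sa π
  ... | A , B , .0 , A<n , B<m , z≤n , |T|≡A+B , A%n , B%m =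
    <⇒≢ 0<|T| (sym (trans |T|≡A+B (cong₂ _+_ (m%n≡0∧m<n⇒m≡0 A%n (s≤s A<n))
                                               (m%n≡0∧m<n⇒m≡0 B%m (s≤s B<m)))))

  Sb-no-short-product-one : m ≤ n → ∀ {ex} → ex ≤ n → ¬ HasShortProductOneSub ex Sb
  Sb-no-short-product-one m≤n ex≤n (T , T⊆Sb , 1≤|T| , |T|≤ex , π) with product-one-subword T⊆Sb π
  ... | A , B , K , A<n , B<m , K<m , |T|≡ , KA%n , KB%m =
    <⇒≢ 1≤|T| (sym (trans |T|≡ (short-zero-sum m≤n (s≤s A<n) (s≤s B<m) (s≤s K<m) KA%n KB%m
                                  (subst (_≤ n) |T|≡ (≤-trans |T|≤ex ex≤n)))))

  length-Sa : suc (length Sa) ≡ m + n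
  length-Sa = trans (cong suc (length-word (suc n₀) 1 (suc m₀) 0)) (count n₀ m₀)
    where
    count : ∀ n₀ m₀ → suc (suc n₀ + (1 + suc m₀)) ≡ (2 + m₀) + (2 + n₀)
    count = solve-∀

  length-Sb : 2 + length Sb ≡ 2 * m + n
  length-Sb = trans (cong (2 +_) (length-word (suc n₀) 1 (suc m₀) (suc m₀))) (count n₀ m₀)
    where
    count : ∀ n₀ m₀ → 2 + (suc m₀ + (suc n₀ + (1 + suc m₀))) ≡ 2 * (2 + m₀) + (2 + n₀)
    count = solve-∀

  davenport≥ : ∀ d → IsDavenport d → m + n ∸ 1 ≤ d
  davenport≥ d (_ , maximal) = subst (_≤ d) (cong (_∸ 1) length-Sa) (maximal Sa Sa-product-one-free)

  η≥ : 2 ∣ n → m ∣ n → ∀ ex → IsExponent ex → ∀ η → IsEta ex η → 2 * m + n ∸ 1 ≤ η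
  η≥ 2∣n m∣n ex isEx η (_ , eta , _) = subst (_≤ η) (cong (_∸ 1) length-Sb) (≰⇒> Sb-too-long)
    where
    Sb-too-long : ¬ η ≤ length Sb
    Sb-too-long η≤|Sb| =
      Sb-no-short-product-one (∣⇒≤ m∣n) (exponent≤n 2∣n m∣n isEx) (eta Sb η≤|Sb|)

lemma2p2 : (m n : ℕ) .{{_ : NonZero m}} .{{_ : NonZero n}} → 2 ≤ m → 3 ≤ n → m ∣ n →
    let open SeqNotions (mulDC n m) (oneDC n m) in
    (∀ d → IsDavenport d → m + n ∸ 1 ≤ d)
    × (2 ∣ n → ∀ ex → IsExponent ex → ∀ η → IsEta ex η → 2 * m + n ∸ 1 ≤ η)
lemma2p2 (suc (suc m₀)) (suc (suc n₀)) (s≤s (s≤s _)) (s≤s (s≤s _)) m∣n =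
  davenport≥ , λ 2∣n → η≥ 2∣n m∣n
  where open ExtremalSequences n₀ m₀
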